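{- For every word $z\in\{a,b\}^\star$ there exists an integer $t\ge1$ such that $A M^{z} B - B M^{\overline{z}} A = t\,U$, where $U=\begin{pmatrix}0&-1\\1&0\end{pmatrix}$.
   Context: For a word $w$, $\overline{w}$ denotes its reversal. Let $A=\begin{pmatrix}1&1\\1&2\end{pmatrix}$, $B=\begin{pmatrix}2&1\\1&1\end{pmatrix}$, and for $w=x_1\cdots x_k\in\{a,b\}^\star$ let $M^w=M^{x_1}\cdots M^{x_k}$ with $M^a=A$, $M^b=B$ ($M^w=I$ for the empty word). -}

module Defs where

open import Data.Integer using (ℤ; +_; -[1+_]; _+_; _*_; _-_; -_)
open import Data.List using (List; []; _∷_; reverse)

data Letter : Set where
  a b : Letter

Word : Set
Word = List Letter

record Mat₂ : Set where
  constructor mat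
  field
    m11 m12 m21 m22 : ℤ
open Mat₂ public

_⊗_ : Mat₂ → Mat₂ → Mat₂
mat p q r s ⊗ mat p' q' r' s' =
  mat (p * p' + q * r') (p * q' + q * s') (r * p' + s * r') (r * q' + s * s')

_⊖_ : Mat₂ → Mat₂ → Mat₂
mat p q r s ⊖ mat p' q' r' s' = mat (p - p') (q - q') (r - r') (s - s')

_·_ : ℤ → Mat₂ → Mat₂
t · mat p q r s = mat (t * p) (t * q) (t * r) (t * s)

I₂ : Mat₂
I₂ = mat (+ 1) (+ 0) (+ 0) (+ 1)

A : Mat₂
A = mat (+ 1) (+ 1) (+ 1) (+ 2)

B : Mat₂
B = mat (+ 2) (+ 1) (+ 1) (+ 1)

U : Mat₂
U = mat (+ 0) (- (+ 1)) (+ 1) (+ 0)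

M : Letter → Mat₂
M a = A
M b = B

Mʷ : Word → Mat₂
Mʷ [] = I₂
Mʷ (x ∷ w) = M x ⊗ Mʷ w

rev : Word → Word
rev = reverse

-- Reversing a word transposes its matrix, since A and B are symmetric; so for X = M^z the
-- difference is A X B − B Xᵀ A, which for any X = (p q / r s) is the polynomial identity
-- A X B − B Xᵀ A = (p + 3r + s) U. Every M^z is a product of matrices with entries in ℕ and
-- positive top-left entry, so p ≥ 1 and q, r, s ≥ 0 give p + 3r + s ≥ 1.
module Submission where

open import Defs
open import Data.Integer using (ℤ; +_; +[1+_]; _+_; _*_; _-_; -_; _≤_; +≤+)
open import Data.Integer.Properties using (pos-+; pos-*)
open import Data.Integer.Tactic.RingSolver using (solve-∀)
open import Data.List using ([]; _∷_; _++_; [_]; reverse)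
open import Data.List.Properties using (unfold-reverse)
import Data.Nat as ℕ
open import Data.Product using (Σ; _×_; _,_)
open import Relation.Binary.PropositionalEquality
  using (_≡_; refl; sym; cong; cong₂; subst; module ≡-Reasoning)

open ≡-Reasoning

mat-cong : ∀ {p q r s p′ q′ r′ s′} →
           p ≡ p′ → q ≡ q′ → r ≡ r′ → s ≡ s′ → mat p q r s ≡ mat p′ q′ r′ s′
mat-cong refl refl refl refl = refl

infix 30 _ᵀ

_ᵀ : Mat₂ → Mat₂
mat p q r s ᵀ = mat p r q s

⊗-assoc : ∀ X Y Z → (X ⊗ Y) ⊗ Z ≡ X ⊗ (Y ⊗ Z)
⊗-assoc (mat x₁ x₂ x₃ x₄) (mat e f g h) (mat i j k l) =
  mat-cong (entry x₁ x₂ e f g h i k) (entry x₁ x₂ e f g h j l)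
           (entry x₃ x₄ e f g h i k) (entry x₃ x₄ e f g h j l)
  where
  entry : ∀ (y₁ y₂ e f g h i k : ℤ) →
          (y₁ * e + y₂ * g) * i + (y₁ * f + y₂ * h) * k ≡ y₁ * (e * i + f * k) + y₂ * (g * i + h * k)
  entry = solve-∀

⊗-identityˡ : ∀ X → I₂ ⊗ X ≡ X
⊗-identityˡ (mat p q r s) = mat-cong (top p r) (top q s) (bottom p r) (bottom q s)
  where
  top : ∀ (x y : ℤ) → + 1 * x + + 0 * y ≡ x
  top = solve-∀
  bottom : ∀ (x y : ℤ) → + 0 * x + + 1 * y ≡ y
  bottom = solve-∀

⊗-identityʳ : ∀ X → X ⊗ I₂ ≡ X
⊗-identityʳ (mat p q r s) = mat-cong (left p q) (right p q) (left r s) (right r s)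
  where
  left : ∀ (x y : ℤ) → x * + 1 + y * + 0 ≡ x
  left = solve-∀
  right : ∀ (x y : ℤ) → x * + 0 + y * + 1 ≡ y
  right = solve-∀

ᵀ-⊗ : ∀ X Y → (X ⊗ Y) ᵀ ≡ Y ᵀ ⊗ X ᵀ
ᵀ-⊗ (mat x₁ x₂ x₃ x₄) (mat e f g h) =
  mat-cong (entry x₁ x₂ e g) (entry x₃ x₄ e g) (entry x₁ x₂ f h) (entry x₃ x₄ f h)
  where
  entry : ∀ (y₁ y₂ e g : ℤ) → y₁ * e + y₂ * g ≡ e * y₁ + g * y₂
  entry = solve-∀

Mʷ-++ : ∀ u v → Mʷ (u ++ v) ≡ Mʷ u ⊗ Mʷ v
Mʷ-++ []      v = sym (⊗-identityˡ (Mʷ v))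
Mʷ-++ (x ∷ u) v = begin
  M x ⊗ Mʷ (u ++ v)    ≡⟨ cong (M x ⊗_) (Mʷ-++ u v) ⟩
  M x ⊗ (Mʷ u ⊗ Mʷ v)  ≡⟨ sym (⊗-assoc (M x) (Mʷ u) (Mʷ v)) ⟩
  (M x ⊗ Mʷ u) ⊗ Mʷ v  ∎

M-symmetric : ∀ x → M x ᵀ ≡ M x
M-symmetric a = refl
M-symmetric b = refl

Mʷ-reverse : ∀ w → Mʷ (reverse w) ≡ Mʷ w ᵀ
Mʷ-reverse []      = refl
Mʷ-reverse (x ∷ w) = begin
  Mʷ (reverse (x ∷ w))         ≡⟨ cong Mʷ (unfold-reverse x w) ⟩
  Mʷ (reverse w ++ [ x ])      ≡⟨ Mʷ-++ (reverse w) [ x ] ⟩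
  Mʷ (reverse w) ⊗ (M x ⊗ I₂)  ≡⟨ cong₂ _⊗_ (Mʷ-reverse w) (⊗-identityʳ (M x)) ⟩
  Mʷ w ᵀ ⊗ M x                 ≡⟨ cong (Mʷ w ᵀ ⊗_) (sym (M-symmetric x)) ⟩
  Mʷ w ᵀ ⊗ M x ᵀ               ≡⟨ sym (ᵀ-⊗ (M x) (Mʷ w)) ⟩
  (M x ⊗ Mʷ w) ᵀ               ∎

skewCoefficient : Mat₂ → ℤ
skewCoefficient X = m11 X + + 3 * m21 X + m22 X

-- The entries below are those of A X B − B Xᵀ A exactly as _⊗_ and _⊖_ compute them.
A⊗X⊗B⊖B⊗Xᵀ⊗A : ∀ X → (A ⊗ (X ⊗ B)) ⊖ (B ⊗ (X ᵀ ⊗ A)) ≡ skewCoefficient X · U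
A⊗X⊗B⊖B⊗Xᵀ⊗A (mat p q r s) =
  mat-cong (entry₁₁ p q r s) (entry₁₂ p q r s) (entry₂₁ p q r s) (entry₂₂ p q r s)
  where
  entry₁₁ : ∀ p q r s →
    (+ 1 * (p * + 2 + q * + 1) + + 1 * (r * + 2 + s * + 1))
      - (+ 2 * (p * + 1 + r * + 1) + + 1 * (q * + 1 + s * + 1))
    ≡ (p + + 3 * r + s) * + 0
  entry₁₁ = solve-∀
  entry₁₂ : ∀ p q r s →
    (+ 1 * (p * + 1 + q * + 1) + + 1 * (r * + 1 + s * + 1))
      - (+ 2 * (p * + 1 + r * + 2) + + 1 * (q * + 1 + s * + 2))
    ≡ (p + + 3 * r + s) * - (+ 1)
  entry₁₂ = solve-∀
  entry₂₁ : ∀ p q r s →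
    (+ 1 * (p * + 2 + q * + 1) + + 2 * (r * + 2 + s * + 1))
      - (+ 1 * (p * + 1 + r * + 1) + + 1 * (q * + 1 + s * + 1))
    ≡ (p + + 3 * r + s) * + 1
  entry₂₁ = solve-∀
  entry₂₂ : ∀ p q r s →
    (+ 1 * (p * + 1 + q * + 1) + + 2 * (r * + 1 + s * + 1))
      - (+ 1 * (p * + 1 + r * + 2) + + 1 * (q * + 1 + s * + 2))
    ≡ (p + + 3 * r + s) * + 0
  entry₂₂ = solve-∀

data Natural⁺ : Mat₂ → Set where
  natural⁺ : ∀ p q r s → Natural⁺ (mat +[1+ p ] (+ q) (+ r) (+ s))

pos-dot : ∀ m n k l → + (m ℕ.* n ℕ.+ k ℕ.* l) ≡ + m * + n + + k * + l
pos-dot m n k l = begin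
  + (m ℕ.* n ℕ.+ k ℕ.* l)      ≡⟨ pos-+ (m ℕ.* n) (k ℕ.* l) ⟩
  + (m ℕ.* n) + + (k ℕ.* l)    ≡⟨ cong₂ _+_ (pos-* m n) (pos-* k l) ⟩
  + m * + n + + k * + l        ∎

Natural⁺-⊗ : ∀ {X Y} → Natural⁺ X → Natural⁺ Y → Natural⁺ (X ⊗ Y)
Natural⁺-⊗ (natural⁺ p q r s) (natural⁺ p′ q′ r′ s′) =
  subst Natural⁺
    (mat-cong (pos-dot (ℕ.suc p) (ℕ.suc p′) q r′) (pos-dot (ℕ.suc p) q′ q s′)
              (pos-dot r (ℕ.suc p′) s r′) (pos-dot r q′ s s′))
    (natural⁺ _ _ _ _)

Natural⁺-Mʷ : ∀ w → Natural⁺ (Mʷ w)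
Natural⁺-Mʷ []      = natural⁺ 0 0 0 1
Natural⁺-Mʷ (a ∷ w) = Natural⁺-⊗ (natural⁺ 0 1 1 2) (Natural⁺-Mʷ w)
Natural⁺-Mʷ (b ∷ w) = Natural⁺-⊗ (natural⁺ 1 1 1 1) (Natural⁺-Mʷ w)

Natural⁺⇒1≤skewCoefficient : ∀ {X} → Natural⁺ X → + 1 ≤ skewCoefficient X
Natural⁺⇒1≤skewCoefficient (natural⁺ p q r s)
  rewrite sym (pos-* 3 r)
        | sym (pos-+ (ℕ.suc p) (3 ℕ.* r))
        | sym (pos-+ (ℕ.suc p ℕ.+ 3 ℕ.* r) s)
        = +≤+ (ℕ.s≤s ℕ.z≤n)

lemma2p9 : (z : Word) → Σ ℤ (λ t → (+ 1 ≤ t) × ((A ⊗ (Mʷ z ⊗ B)) ⊖ (B ⊗ (Mʷ (rev z) ⊗ A)) ≡ t · U))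
lemma2p9 z = skewCoefficient (Mʷ z) , Natural⁺⇒1≤skewCoefficient (Natural⁺-Mʷ z) , (begin
  (A ⊗ (Mʷ z ⊗ B)) ⊖ (B ⊗ (Mʷ (reverse z) ⊗ A))  ≡⟨ cong (λ Y → (A ⊗ (Mʷ z ⊗ B)) ⊖ (B ⊗ (Y ⊗ A))) (Mʷ-reverse z) ⟩
  (A ⊗ (Mʷ z ⊗ B)) ⊖ (B ⊗ (Mʷ z ᵀ ⊗ A))          ≡⟨ A⊗X⊗B⊖B⊗Xᵀ⊗A (Mʷ z) ⟩
  skewCoefficient (Mʷ z) · U                     ∎)
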